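{- For an integer $m\ge 3$, let $G_{4m+2}$ be the graph with vertex set $\{x,y,z\}\cup\{y_1,\dots,y_{2m-1}\}\cup\{z_1,\dots,z_{2m}\}$ and edge set $\{yz\}\cup\{xy_i,\ y_iy : 1\le i\le 2m-1\}\cup\{xz_i,\ z_iz: 1\le i\le 2m\}\cup\{y_iy_{1+((i+m-2)\bmod (2m-1))}: 1\le i\le 2m-1\}\cup\{z_iz_j: 1\le i<j\le 2m,\ j\ne i+m\}\cup\{y_iz_j: 1\le i\le 2m-1,\ 1\le j\le 2m,\ j\ne i,\ j\ne i+1\}$. Then $\gamma_t(G_{4m+2}-v)=2$ for every vertex $v\in V(G_{4m+2})$.
   Context: A set $S\subseteq V(G)$ is a total dominating set of a graph $G$ if every vertex of $G$ (including those in $S$) is adjacent to some vertex of $S$; $\gamma_t(G)$ is the minimum cardinality of a total dominating set. -}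

module Defs where

open import Data.Nat using (ℕ; zero; suc; _+_; _*_; _∸_; _≤_; _<_)
open import Data.Nat.DivMod using (_%_)
open import Data.Product using (Σ; ∃; _×_; _,_; proj₁)
open import Data.Sum using (_⊎_)
open import Data.List using (List; length)
open import Data.List.Membership.Propositional using (_∈_)
open import Data.List.Relation.Unary.Unique.Propositional using (Unique)
open import Relation.Binary.PropositionalEquality using (_≡_; _≢_)

record Graph : Set₁ where
  field
    Vertex : Set
    Adj    : Vertex → Vertex → Set
open Graph public

_─_ : (G : Graph) → Vertex G → Graph
Vertex (G ─ v) = Σ (Vertex G) (λ u → u ≢ v)
Adj    (G ─ v) (a , _) (b , _) = Adj G a b

IsTotalDominatingSet : (G : Graph) → List (Vertex G) → Set
IsTotalDominatingSet G S = ∀ u → Σ (Vertex G) (λ s → s ∈ S × Adj G u s)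

TotalDominationNumber≡ : Graph → ℕ → Set
TotalDominationNumber≡ G k =
  (Σ (List (Vertex G)) λ S → Unique S × length S ≡ k × IsTotalDominatingSet G S)
  × (∀ (S : List (Vertex G)) → Unique S → IsTotalDominatingSet G S → k ≤ length S)

data Vtx (m : ℕ) : Set where
  vx vy vz : Vtx m
  vy' : (i : ℕ) → 1 ≤ i → i ≤ 2 * m ∸ 1 → Vtx m
  vz' : (j : ℕ) → 1 ≤ j → j ≤ 2 * m → Vtx m

-- The edge list (each edge listed in one orientation).
-- Note: 2m-1 is written  suc (2 * m ∸ 2)  (equal for m ≥ 1) so that the
-- divisor of _%_ is syntactically nonzero.
data Edge (m : ℕ) : Vtx m → Vtx m → Set where
  e-yz  : Edge m vy vz
  e-xyi : ∀ {i a b} → Edge m vx (vy' i a b)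
  e-yiy : ∀ {i a b} → Edge m (vy' i a b) vy
  e-xzi : ∀ {j a b} → Edge m vx (vz' j a b)
  e-ziz : ∀ {j a b} → Edge m (vz' j a b) vz
  e-yy  : ∀ {i a b j c d} → j ≡ suc ((i + m ∸ 2) % suc (2 * m ∸ 2))
          → Edge m (vy' i a b) (vy' j c d)
  e-zz  : ∀ {i a b j c d} → i < j → j ≢ i + m
          → Edge m (vz' i a b) (vz' j c d)
  e-yz' : ∀ {i a b j c d} → j ≢ i → j ≢ suc i
          → Edge m (vy' i a b) (vz' j c d)

G : ℕ → Graph
Vertex (G m) = Vtx m
Adj    (G m) u v = Edge m u v ⊎ Edge m v u

module Submission where

-- γ_t ≥ 2: a one-element total dominating set {s} would need every vertex, s included,
-- to be adjacent to s; but G has no loops at x, y, z, z_k, and y_i misses both z_i and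
-- z_{i+1}, one of which survives the deletion of v.
--
-- γ_t ≤ 2: for v ∈ {x, y, z} take {y, z}, {x, z_1}, {x, y_1}.  Otherwise take {y_a, z_b}
-- with b ∉ {a, a+1}.  Then z_b dominates x, z, every y_k except y_{b-1}, y_b, and every
-- z_k except its antipodes z_{b±m}; y_a dominates y and z_b.  So it suffices that each of
-- y_{b-1}, y_b is v or a cycle-neighbour of y_a, and that each antipode of z_b is v or
-- has index outside {a, a+1}.  With σ the y-cycle, the cycle-neighbours of y_{σ(b)} are
-- y_{b-1} and y_b, so for v = z_j the pair with a = σ(b), b the unique antipode of j,
-- works; for v = y_i one takes b ∈ {i, i+1} and a with y_a adjacent to the other of
-- y_{b-1}, y_b, on the side where the antipode of z_b misses {a, a+1}.

open import Defs
open import Data.Nat using (ℕ; zero; suc; _+_; _*_; _∸_; _≤_; _≰_; _<_; z≤n; s≤s; _≟_; _≤?_)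
open import Data.Nat.Properties
open import Data.Nat.DivMod using (_%_; m≤n⇒m%n≡m; [m+n]%n≡m%n)
open import Data.Nat.Tactic.RingSolver using (solve)
open import Data.Empty using (⊥-elim)
open import Data.List using (List; []; _∷_; length)
open import Data.List.Membership.Propositional using (_∈_)
open import Data.List.Relation.Unary.Any using (here; there)
open import Data.List.Relation.Unary.All using () renaming ([] to []ᴬ; _∷_ to _∷ᴬ_)
open import Data.List.Relation.Unary.AllPairs using () renaming ([] to []ᴾ; _∷_ to _∷ᴾ_)
open import Data.List.Relation.Unary.Unique.Propositional using (Unique)
open import Data.Product using (Σ; _×_; _,_; proj₁; uncurry)
open import Data.Sum using (_⊎_; inj₁; inj₂; [_,_])
open import Relation.Binary.Definitions using (tri<; tri≈; tri>)
open import Relation.Binary.PropositionalEquality using (_≡_; _≢_; refl; sym; trans; cong; subst; module ≡-Reasoning)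
open import Function using (_∘_)
open import Relation.Nullary using (¬_; yes; no; contradiction)
open import Relation.Nullary.Decidable using (_⊎-dec_)

TotalDominatingPair : Graph → Set
TotalDominatingPair H =
  Σ (List (Vertex H)) λ S → Unique S × length S ≡ 2 × IsTotalDominatingSet H S

totalDominatingPair : (H : Graph) (s t : Vertex H) → s ≢ t
                    → (∀ u → Adj H u s ⊎ Adj H u t) → TotalDominatingPair H
totalDominatingPair H s t s≢t dominates =
  (s ∷ t ∷ []) , (s≢t ∷ᴬ []ᴬ) ∷ᴾ ([]ᴬ ∷ᴾ []ᴾ) , refl , λ u → witness (dominates u)
  where
  witness : ∀ {u} → Adj H u s ⊎ Adj H u t → Σ (Vertex H) λ w → w ∈ s ∷ t ∷ [] × Adj H u w
  witness (inj₁ u~s) = s , here refl , u~s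
  witness (inj₂ u~t) = t , there (here refl) , u~t

totalDominatingSet-2≤length : (H : Graph) → Vertex H → (∀ s → ¬ (∀ u → Adj H u s))
                            → ∀ S → IsTotalDominatingSet H S → 2 ≤ length S
totalDominatingSet-2≤length H w noUniversal [] dominates with dominates w
... | _ , () , _
totalDominatingSet-2≤length H w noUniversal (s ∷ []) dominates =
  ⊥-elim (noUniversal s λ u → adjacent-to-s (dominates u))
  where
  adjacent-to-s : ∀ {u} → Σ (Vertex H) (λ t → t ∈ s ∷ [] × Adj H u t) → Adj H u s
  adjacent-to-s (_ , here refl , u~s) = u~s
totalDominatingSet-2≤length H w noUniversal (_ ∷ _ ∷ _) dominates = s≤s (s≤s z≤n)

totalDominationNumber≡2 : (H : Graph) → Vertex H → (∀ s → ¬ (∀ u → Adj H u s))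
                        → TotalDominatingPair H → TotalDominationNumber≡ H 2
totalDominationNumber≡2 H w noUniversal pair =
  pair , λ S _ → totalDominatingSet-2≤length H w noUniversal S

≤-by : ∀ {x y} d → x + d ≡ y → x ≤ y
≤-by {x} d refl = m≤m+n x d

≤∸1⇒< : ∀ {i x} → 1 ≤ i → i ≤ x ∸ 1 → i < x
≤∸1⇒< {x = zero}  (s≤s _) ()
≤∸1⇒< {x = suc x} _       i≤x = s≤s i≤x

<⇒≤∸1 : ∀ {i x} → i < x → i ≤ x ∸ 1
<⇒≤∸1 {i} {x} i<x = subst (i ≤_) (pred[m∸n]≡m∸[1+n] x 0) (<⇒≤pred i<x)

1+i≤x∸1⇒i≤x∸2 : ∀ {i x} → suc i ≤ x ∸ 1 → i ≤ x ∸ 2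
1+i≤x∸1⇒i≤x∸2 {i} {x} le = subst (i ≤_) (pred[m∸n]≡m∸[1+n] x 1) (pred-mono-≤ le)

module _ {m : ℕ} where

  vy'-injective : ∀ {i j p q p′ q′} → vy' {m} i p q ≡ vy' j p′ q′ → i ≡ j
  vy'-injective refl = refl

  vz'-injective : ∀ {i j p q p′ q′} → vz' {m} i p q ≡ vz' j p′ q′ → i ≡ j
  vz'-injective refl = refl

  vy'-cong : ∀ {i j p q p′ q′} → i ≡ j → vy' {m} i p q ≡ vy' j p′ q′
  vy'-cong {p = p} {q} {p′} {q′} refl
    rewrite ≤-irrelevant p p′ | ≤-irrelevant q q′ = refl

  vz'-cong : ∀ {i j p q p′ q′} → i ≡ j → vz' {m} i p q ≡ vz' j p′ q′
  vz'-cong {p = p} {q} {p′} {q′} refl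
    rewrite ≤-irrelevant p p′ | ≤-irrelevant q q′ = refl

-- The y-cycle y_i ↦ y_{1 + ((i+m-2) mod (2m-1))} is i ↦ i+m-1 for i ≤ m and i ↦ i-m for i > m.
yy-shift : ∀ {m i j a b c d} → i + m ≡ suc j → Edge m (vy' i a b) (vy' j c d)
yy-shift {m} {suc i} {suc j} {d = d} eq = e-yy (cong suc (sym (trans
  (cong (λ t → (t ∸ 1) % suc (2 * m ∸ 2)) (suc-injective eq))
  (m≤n⇒m%n≡m (1+i≤x∸1⇒i≤x∸2 {x = 2 * m} d)))))

yy-wrap : ∀ {m i j a b c d} → i ≡ j + m → Edge m (vy' i a b) (vy' j c d)
yy-wrap {zero} {b = ()} {c = s≤s z≤n} refl
yy-wrap {suc m} {j = suc j} {d = d} refl = e-yy (cong suc (sym (begin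
  (suc j + suc m + suc m ∸ 2) % suc k  ≡⟨ cong (λ t → (t ∸ 2) % suc k) shift ⟩
  (j + suc k + 2 ∸ 2) % suc k          ≡⟨ cong (_% suc k) (m+n∸n≡m (j + suc k) 2) ⟩
  (j + suc k) % suc k                  ≡⟨ [m+n]%n≡m%n j (suc k) ⟩
  j % suc k                            ≡⟨ m≤n⇒m%n≡m (1+i≤x∸1⇒i≤x∸2 {x = 2 * suc m} d) ⟩
  j                                    ∎)))
  where
  open ≡-Reasoning
  k = 2 * suc m ∸ 2
  k+2≡2m : k + 2 ≡ 2 * suc m
  k+2≡2m = m∸n+n≡m {2 * suc m} {2} (*-monoʳ-≤ 2 (s≤s z≤n))
  shift : suc j + suc m + suc m ≡ j + suc k + 2
  shift = begin
    suc j + suc m + suc m  ≡⟨ x+y+y≡x+2y (suc j) (suc m) ⟩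
    suc j + 2 * suc m      ≡⟨ cong (suc j +_) (sym k+2≡2m) ⟩
    suc j + (k + 2)        ≡⟨ 1+x+[y+2]≡x+1+y+2 j k ⟩
    j + suc k + 2          ∎
    where
    x+y+y≡x+2y : ∀ x y → x + y + y ≡ x + 2 * y
    x+y+y≡x+2y x y = solve (x ∷ y ∷ [])
    1+x+[y+2]≡x+1+y+2 : ∀ x y → suc x + (y + 2) ≡ x + suc y + 2
    1+x+[y+2]≡x+1+y+2 x y = solve (x ∷ y ∷ [])

zz-adj : ∀ {m k l p q p′ q′} → k ≢ l → l ≢ k + m → k ≢ l + m
       → Adj (G m) (vz' k p q) (vz' l p′ q′)
zz-adj {k = k} {l} k≢l l≢k+m k≢l+m with <-cmp k l
... | tri< k<l _ _ = inj₁ (e-zz k<l l≢k+m)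
... | tri≈ _ k≡l _ = contradiction k≡l k≢l
... | tri> _ _ l<k = inj₂ (e-zz l<k k≢l+m)

no-antipode-above : ∀ {m b k} → m < b → k ≡ b + m → k ≰ 2 * m
no-antipode-above {m} {b} m<b refl = <⇒≱ (begin-strict
  2 * m   ≡⟨ cong (m +_) (+-identityʳ m) ⟩
  m + m   <⟨ +-monoˡ-< m m<b ⟩
  b + m   ∎)
  where open ≤-Reasoning

no-antipode-below : ∀ {m b k} → 1 ≤ k → b ≤ m → b ≢ k + m
no-antipode-below {m} 1≤k b≤m refl = ≤⇒≯ b≤m (m<n+m m 1≤k)

_∉[_,_] : ℕ → ℕ → ℕ → Set
k ∉[ a , b ] = k < a ⊎ b < k

∉[a,1+a]⇒≢ : ∀ {k a} → k ∉[ a , suc a ] → k ≢ a × k ≢ suc a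
∉[a,1+a]⇒≢ (inj₁ k<a)   = <⇒≢ k<a , <⇒≢ (m<n⇒m<1+n k<a)
∉[a,1+a]⇒≢ (inj₂ 1+a<k) = >⇒≢ (<-trans (n<1+n _) 1+a<k) , >⇒≢ 1+a<k

-- Junk value 0 off the z-vertices; real z-indices are ≥ 1.
zIndex : ∀ {m} → Vtx m → ℕ
zIndex (vz' j _ _) = j
zIndex _           = 0

y-nonNeighbour : ∀ {m} (v : Vtx m) i p q
               → Σ (Vertex (G m ─ v)) λ u → ¬ Adj (G m) (proj₁ u) (vy' i p q)
y-nonNeighbour v i p q with zIndex v ≟ i
... | yes zv≡i = (vz' (suc i) (s≤s z≤n) (≤∸1⇒< p q) , λ e → 1+n≢n (trans (cong zIndex e) zv≡i))
               , λ { (inj₁ ()) ; (inj₂ (e-yz' _ 1+i≢1+i)) → 1+i≢1+i refl }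
... | no zv≢i  = (vz' i p (≤-trans q (m∸n≤m _ 1)) , λ e → zv≢i (sym (cong zIndex e)))
               , λ { (inj₁ ()) ; (inj₂ (e-yz' i≢i _)) → i≢i refl }

noUniversalVertex : ∀ {m} (v : Vtx m) (s : Vertex (G m ─ v)) → ¬ (∀ u → Adj (G m ─ v) u s)
noUniversalVertex v (vx , x≢v) universal = [ (λ ()) , (λ ()) ] (universal (vx , x≢v))
noUniversalVertex v (vy , y≢v) universal = [ (λ ()) , (λ ()) ] (universal (vy , y≢v))
noUniversalVertex v (vz , z≢v) universal = [ (λ ()) , (λ ()) ] (universal (vz , z≢v))
noUniversalVertex v (vz' k p q , z≢v) universal = [ noLoop , noLoop ] (universal (vz' k p q , z≢v))
  where
  noLoop : ¬ Edge _ (vz' k p q) (vz' k p q)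
  noLoop (e-zz k<k _) = <-irrefl refl k<k
noUniversalVertex v (vy' i p q , _) universal =
  let u , u≁y = y-nonNeighbour v i p q in u≁y (universal u)

vertexOtherThan : ∀ {m} (v : Vtx m) → Vertex (G m ─ v)
vertexOtherThan vx            = vy , λ ()
vertexOtherThan vy            = vx , λ ()
vertexOtherThan vz            = vx , λ ()
vertexOtherThan (vy' _ _ _)   = vx , λ ()
vertexOtherThan (vz' _ _ _)   = vx , λ ()

-- A pair {y_a, z_b} dominates everything except possibly y_a, y_b, y_{b-1} and the
-- z_k with |k - b| ∈ {0, m}; the hypotheses cover exactly these vertices.
dominatingPair-yz : ∀ {m} (v : Vtx m) a pa qa b pb qb
  → vy' a pa qa ≢ v → vz' b pb qb ≢ v → b ∉[ a , suc a ]
  → (∀ k p q → vz' k p q ≢ v → b ≡ k + m ⊎ k ≡ b + m → k ∉[ a , suc a ])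
  → (∀ k p q → vy' k p q ≢ v → k ≡ b ⊎ suc k ≡ b → Adj (G m) (vy' k p q) (vy' a pa qa))
  → TotalDominatingPair (G m ─ v)
dominatingPair-yz {m} v a pa qa b pb qb ya≢v zb≢v b∉[a,1+a] zPartner yNeighbour =
  totalDominatingPair (G m ─ v) ya zb (λ ()) dominates
  where
  ya zb : Vertex (G m ─ v)
  ya = vy' a pa qa , ya≢v
  zb = vz' b pb qb , zb≢v
  dominates : ∀ u → Adj (G m ─ v) u ya ⊎ Adj (G m ─ v) u zb
  dominates (vx , _) = inj₂ (inj₁ e-xzi)
  dominates (vy , _) = inj₁ (inj₂ e-yiy)
  dominates (vz , _) = inj₂ (inj₂ e-ziz)
  dominates (vy' k p q , yk≢v) with (k ≟ b) ⊎-dec (suc k ≟ b)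
  ... | yes k∈[b-1,b] = inj₁ (yNeighbour k p q yk≢v k∈[b-1,b])
  ... | no  k∉[b-1,b] = inj₂ (inj₁ (e-yz' (k∉[b-1,b] ∘ inj₁ ∘ sym) (k∉[b-1,b] ∘ inj₂ ∘ sym)))
  dominates (vz' k p q , zk≢v) with k ≟ b | (b ≟ k + m) ⊎-dec (k ≟ b + m)
  ... | yes refl | _ = inj₁ (inj₂ (uncurry e-yz' (∉[a,1+a]⇒≢ b∉[a,1+a])))
  ... | no _ | yes partner = inj₁ (inj₂ (uncurry e-yz' (∉[a,1+a]⇒≢ (zPartner k p q zk≢v partner))))
  ... | no k≢b | no ¬partner = inj₂ (zz-adj k≢b (¬partner ∘ inj₁) (¬partner ∘ inj₂))

dominatingPair-x : ∀ {m} → TotalDominatingPair (G m ─ vx)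
dominatingPair-x {m} = totalDominatingPair (G m ─ vx) (vy , λ ()) (vz , λ ()) (λ ()) dominates
  where
  dominates : ∀ u → Adj (G m ─ vx) u (vy , λ ()) ⊎ Adj (G m ─ vx) u (vz , λ ())
  dominates (vx , x≢x)       = contradiction refl x≢x
  dominates (vy , _)         = inj₂ (inj₁ e-yz)
  dominates (vz , _)         = inj₁ (inj₂ e-yz)
  dominates (vy' _ _ _ , _)  = inj₁ (inj₁ e-yiy)
  dominates (vz' _ _ _ , _)  = inj₂ (inj₁ e-ziz)

module _ (n : ℕ) where

  dominatingPair-y : TotalDominatingPair (G (3 + n) ─ vy)
  dominatingPair-y = totalDominatingPair (G (3 + n) ─ vy) (vx , λ ()) z₁ (λ ()) dominates
    where
    z₁ : Vertex (G (3 + n) ─ vy)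
    z₁ = vz' 1 (s≤s z≤n) (s≤s z≤n) , λ ()
    dominates : ∀ u → Adj (G (3 + n) ─ vy) u (vx , λ ()) ⊎ Adj (G (3 + n) ─ vy) u z₁
    dominates (vx , _)         = inj₂ (inj₁ e-xzi)
    dominates (vy , y≢y)       = contradiction refl y≢y
    dominates (vz , _)         = inj₂ (inj₂ e-ziz)
    dominates (vy' _ _ _ , _)  = inj₁ (inj₂ e-xyi)
    dominates (vz' _ _ _ , _)  = inj₁ (inj₂ e-xzi)

  dominatingPair-z : TotalDominatingPair (G (3 + n) ─ vz)
  dominatingPair-z = totalDominatingPair (G (3 + n) ─ vz) (vx , λ ()) y₁ (λ ()) dominates
    where
    y₁ : Vertex (G (3 + n) ─ vz)
    y₁ = vy' 1 (s≤s z≤n) (s≤s z≤n) , λ ()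
    dominates : ∀ u → Adj (G (3 + n) ─ vz) u (vx , λ ()) ⊎ Adj (G (3 + n) ─ vz) u y₁
    dominates (vx , _)         = inj₂ (inj₁ e-xyi)
    dominates (vy , _)         = inj₂ (inj₂ e-yiy)
    dominates (vz , z≢z)       = contradiction refl z≢z
    dominates (vy' _ _ _ , _)  = inj₁ (inj₂ e-xyi)
    dominates (vz' _ _ _ , _)  = inj₁ (inj₂ e-xzi)

  -- v = y_i with i ≤ m: the pair {y_{i+m-2}, z_i}.
  dominatingPair-yLow : ∀ i p q → i ≤ 3 + n → TotalDominatingPair (G (3 + n) ─ vy' i p q)
  dominatingPair-yLow i p q i≤m = dominatingPair-yz (vy' i p q)
    (i + suc n) pa qa i p (≤-trans i≤m (m≤m+n (3 + n) _))
    (>⇒≢ (m<m+n i (s≤s z≤n)) ∘ vy'-injective) (λ ())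
    (inj₁ (m<m+n i (s≤s z≤n)))
    partner neighbour
    where
    open ≤-Reasoning
    pa : 1 ≤ i + suc n
    pa = ≤-trans p (m≤m+n i (suc n))
    qa : i + suc n ≤ 2 * (3 + n) ∸ 1
    qa = <⇒≤∸1 (begin
      suc (i + suc n)    ≡⟨ solve (n ∷ i ∷ []) ⟩
      i + (2 + n)        ≤⟨ +-monoˡ-≤ (2 + n) i≤m ⟩
      3 + n + (2 + n)    ≤⟨ ≤-by 1 (solve (n ∷ [])) ⟩
      2 * (3 + n)        ∎)
    partner : ∀ k p′ q′ → vz' k p′ q′ ≢ vy' i p q → i ≡ k + (3 + n) ⊎ k ≡ i + (3 + n)
            → k ∉[ i + suc n , suc (i + suc n) ]
    partner _ _ _ _ (inj₂ refl) = inj₂ (≤-by 0 (solve (n ∷ i ∷ [])))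
    partner _ p′ _ _ (inj₁ i≡k+m) = ⊥-elim (no-antipode-below p′ i≤m i≡k+m)
    neighbour : ∀ k p′ q′ → vy' k p′ q′ ≢ vy' i p q → k ≡ i ⊎ suc k ≡ i
              → Adj (G (3 + n)) (vy' k p′ q′) (vy' (i + suc n) pa qa)
    neighbour _ _ _ yk≢v (inj₁ k≡i) = ⊥-elim (yk≢v (vy'-cong k≡i))
    neighbour k _ _ _    (inj₂ refl) = inj₁ (yy-shift (solve (n ∷ k ∷ [])))

  -- v = y_i with i > m: the pair {y_{i-m+2}, z_{i+1}}.
  dominatingPair-yHigh : ∀ o p q → TotalDominatingPair (G (3 + n) ─ vy' (suc (3 + n) + o) p q)
  dominatingPair-yHigh o p q = dominatingPair-yz (vy' (suc (3 + n) + o) p q)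
    (3 + o) (s≤s z≤n) qa (suc (suc (3 + n) + o)) (s≤s z≤n) b≤2m
    (<⇒≢ a<i ∘ vy'-injective) (λ ())
    (inj₂ (≤-by n (solve (n ∷ o ∷ []))))
    partner neighbour
    where
    open ≤-Reasoning
    b≤2m : suc (suc (3 + n) + o) ≤ 2 * (3 + n)
    b≤2m = ≤∸1⇒< p q
    o≤1+n : o ≤ 1 + n
    o≤1+n = +-cancelˡ-≤ (5 + n) o (1 + n) (begin
      5 + n + o         ≤⟨ b≤2m ⟩
      2 * (3 + n)       ≡⟨ solve (n ∷ []) ⟩
      5 + n + (1 + n)   ∎)
    qa : 3 + o ≤ 2 * (3 + n) ∸ 1
    qa = <⇒≤∸1 (begin
      4 + o            ≤⟨ +-monoʳ-≤ 4 o≤1+n ⟩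
      4 + (1 + n)      ≤⟨ ≤-by (1 + n) (solve (n ∷ [])) ⟩
      2 * (3 + n)      ∎)
    a<i : 3 + o < suc (3 + n) + o
    a<i = ≤-by n (solve (n ∷ o ∷ []))
    partner : ∀ k p′ q′ → vz' k p′ q′ ≢ vy' (suc (3 + n) + o) p q
            → suc (suc (3 + n) + o) ≡ k + (3 + n) ⊎ k ≡ suc (suc (3 + n) + o) + (3 + n)
            → k ∉[ 3 + o , 4 + o ]
    partner k _ _ _ (inj₁ b≡k+m) = inj₁ (≤-reflexive (cong suc k≡2+o))
      where
      k≡2+o : k ≡ 2 + o
      k≡2+o = +-cancelʳ-≡ (3 + n) k (2 + o) (trans (sym b≡k+m) (solve (n ∷ o ∷ [])))
    partner k _ q′ _ (inj₂ k≡b+m) =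
      ⊥-elim (no-antipode-above (s≤s (≤-trans (n≤1+n (3 + n)) (m≤m+n (suc (3 + n)) o))) k≡b+m q′)
    neighbour : ∀ k p′ q′ → vy' k p′ q′ ≢ vy' (suc (3 + n) + o) p q
              → k ≡ suc (suc (3 + n) + o) ⊎ suc k ≡ suc (suc (3 + n) + o)
              → Adj (G (3 + n)) (vy' k p′ q′) (vy' (3 + o) (s≤s z≤n) qa)
    neighbour _ _ _ _    (inj₁ refl)  = inj₂ (yy-shift (solve (n ∷ o ∷ [])))
    neighbour _ _ _ yk≢v (inj₂ 1+k≡b) = ⊥-elim (yk≢v (vy'-cong (suc-injective 1+k≡b)))

  -- v = z_j with j ≤ m: the pair {y_j, z_{j+m}}.
  dominatingPair-zLow : ∀ j p q → j ≤ 3 + n → TotalDominatingPair (G (3 + n) ─ vz' j p q)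
  dominatingPair-zLow j p q j≤m = dominatingPair-yz (vz' j p q)
    j p qa (j + (3 + n)) (≤-trans p (m≤m+n j _)) qb
    (λ ()) (>⇒≢ (m<m+n j (s≤s z≤n)) ∘ vz'-injective)
    (inj₂ (≤-by (1 + n) (solve (n ∷ j ∷ []))))
    partner neighbour
    where
    open ≤-Reasoning
    qa : j ≤ 2 * (3 + n) ∸ 1
    qa = <⇒≤∸1 (begin
      suc j            ≤⟨ s≤s j≤m ⟩
      4 + n            ≤⟨ ≤-by (2 + n) (solve (n ∷ [])) ⟩
      2 * (3 + n)      ∎)
    qb : j + (3 + n) ≤ 2 * (3 + n)
    qb = begin
      j + (3 + n)           ≤⟨ +-monoˡ-≤ (3 + n) j≤m ⟩
      3 + n + (3 + n)       ≡⟨ solve (n ∷ []) ⟩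
      2 * (3 + n)           ∎
    partner : ∀ k p′ q′ → vz' k p′ q′ ≢ vz' j p q
            → j + (3 + n) ≡ k + (3 + n) ⊎ k ≡ j + (3 + n) + (3 + n)
            → k ∉[ j , suc j ]
    partner k _ _  zk≢v (inj₁ b≡k+m) =
      ⊥-elim (zk≢v (vz'-cong (sym (+-cancelʳ-≡ (3 + n) j k b≡k+m))))
    partner k _ q′ _    (inj₂ k≡b+m) = ⊥-elim (no-antipode-above (m<n+m (3 + n) p) k≡b+m q′)
    neighbour : ∀ k p′ q′ → vy' k p′ q′ ≢ vz' j p q
              → k ≡ j + (3 + n) ⊎ suc k ≡ j + (3 + n)
              → Adj (G (3 + n)) (vy' k p′ q′) (vy' j p qa)
    neighbour _ _ _ _ (inj₁ refl)   = inj₁ (yy-wrap refl)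
    neighbour _ _ _ _ (inj₂ 1+k≡b) = inj₂ (yy-shift (sym 1+k≡b))

  -- v = z_j with j > m: the pair {y_{j-1}, z_{j-m}}.
  dominatingPair-zHigh : ∀ o p q → TotalDominatingPair (G (3 + n) ─ vz' (suc (3 + n) + o) p q)
  dominatingPair-zHigh o p q = dominatingPair-yz (vz' (suc (3 + n) + o) p q)
    (3 + n + o) (s≤s z≤n) (<⇒≤∸1 q) (suc o) (s≤s z≤n) (≤-trans (s≤s (m≤n+m o (3 + n))) q)
    (λ ()) (<⇒≢ b<j ∘ vz'-injective)
    (inj₁ (≤-by (1 + n) (solve (n ∷ o ∷ []))))
    partner neighbour
    where
    open ≤-Reasoning
    b<j : suc o < suc (3 + n) + o
    b<j = ≤-by (2 + n) (solve (n ∷ o ∷ []))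
    b≤m : suc o ≤ 3 + n
    b≤m = s≤s (+-cancelˡ-≤ (4 + n) o (2 + n) (begin
      4 + n + o         ≤⟨ q ⟩
      2 * (3 + n)       ≡⟨ solve (n ∷ []) ⟩
      4 + n + (2 + n)   ∎))
    partner : ∀ k p′ q′ → vz' k p′ q′ ≢ vz' (suc (3 + n) + o) p q
            → suc o ≡ k + (3 + n) ⊎ k ≡ suc o + (3 + n)
            → k ∉[ 3 + n + o , suc (3 + n + o) ]
    partner k p′ _ _    (inj₁ b≡k+m) = ⊥-elim (no-antipode-below p′ b≤m b≡k+m)
    partner k _  _ zk≢v (inj₂ k≡b+m) = ⊥-elim (zk≢v (vz'-cong (trans k≡b+m (solve (n ∷ o ∷ [])))))
    neighbour : ∀ k p′ q′ → vy' k p′ q′ ≢ vz' (suc (3 + n) + o) p q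
              → k ≡ suc o ⊎ suc k ≡ suc o
              → Adj (G (3 + n)) (vy' k p′ q′) (vy' (3 + n + o) (s≤s z≤n) (<⇒≤∸1 q))
    neighbour _ _ _ _ (inj₁ refl) = inj₁ (yy-shift (solve (n ∷ o ∷ [])))
    neighbour _ _ _ _ (inj₂ refl) = inj₂ (yy-wrap (solve (n ∷ o ∷ [])))

  dominatingPair : (v : Vtx (3 + n)) → TotalDominatingPair (G (3 + n) ─ v)
  dominatingPair vx = dominatingPair-x
  dominatingPair vy = dominatingPair-y
  dominatingPair vz = dominatingPair-z
  dominatingPair (vy' i p q) with i ≤? 3 + n
  ... | yes i≤m = dominatingPair-yLow i p q i≤m
  ... | no  i≰m with m≤n⇒∃[o]m+o≡n (≰⇒> i≰m)
  ...   | o , refl = dominatingPair-yHigh o p q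
  dominatingPair (vz' j p q) with j ≤? 3 + n
  ... | yes j≤m = dominatingPair-zLow j p q j≤m
  ... | no  j≰m with m≤n⇒∃[o]m+o≡n (≰⇒> j≰m)
  ...   | o , refl = dominatingPair-zHigh o p q

lemma2p4 : (m : ℕ) → 3 ≤ m → (v : Vtx m) → TotalDominationNumber≡ (G m ─ v) 2
lemma2p4 m 3≤m v with m≤n⇒∃[o]m+o≡n 3≤m
... | n , refl =
  totalDominationNumber≡2 (G (3 + n) ─ v)
    (vertexOtherThan v) (noUniversalVertex v) (dominatingPair n v)
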